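{- Let $t\ge 4$ and let $f:\mathbb{N}\to\mathbb{N}$ be the function $f(r)=(t-3)(2r+1)$. Let $G$ be a graph that does not contain $K_t$ as a minor. Then there exists a connected $f$-flat decomposition of $G$ of width at most $t-2$.
   Context: A decomposition of $G$ is a sequence $(H_1,\ldots,H_\ell)$ of non-empty subgraphs whose vertex sets partition $V(G)$; it is connected if each $H_i$ is connected. A subgraph $H$ of a graph $G'$ $f$-spreads on $G'$ if $|N^{G'}_r[v]\cap V(H)|\le f(r)$ for every $r\in\mathbb{N}$ and every $v\in V(G')$, where $N^{G'}_r[v]$ is the set of vertices at distance at most $r$ from $v$ in $G'$. The decomposition is $f$-flat if each $H_i$ $f$-spreads on $G-\bigcup_{1\le j<i}V(H_j)$. Two vertex-disjoint subgraphs are connected if some edge joins them. For a component $C$ of $G-\bigcup_{1\le j\le i}V(H_j)$, its separating number is the number of graphs among $H_1,\ldots,H_i$ connected to $C$; the width of the decomposition is the maximum separating number of a component of $G-\bigcup_{1\le j<i}V(H_j)$ over all $1\le i\le\ell$. -}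

module Defs where

open import Data.Nat using (ℕ; _≤_; _<_; _*_; _+_; _∸_)
open import Data.Fin using (Fin; toℕ)
open import Data.Bool using (Bool; T)
open import Data.Maybe using (Maybe; just)
open import Data.List using (List; length)
open import Data.List.Relation.Unary.All using (All)
open import Data.List.Relation.Unary.Unique.Propositional using (Unique)
open import Data.Product using (Σ; ∃; _×_)
open import Relation.Binary.PropositionalEquality using (_≡_; _≢_)
open import Relation.Nullary using (¬_)

record Graph : Set where
  field
    n     : ℕ
    adj   : Fin n → Fin n → Bool
    sym   : ∀ u v → adj u v ≡ adj v u
    irrefl : ∀ v → adj v v ≡ Data.Bool.false

open Graph public

Vtx : Graph → Set
Vtx G = Fin (n G)

Edge : (G : Graph) → Vtx G → Vtx G → Set
Edge G u v = T (adj G u v)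

data Walk {A : Set} (R : A → A → Set) : A → A → Set where
  here : ∀ {u} → Walk R u u
  step : ∀ {u w v} → R u w → Walk R w v → Walk R u v

data WalkN {A : Set} (R : A → A → Set) : ℕ → A → A → Set where
  here : ∀ {u} → WalkN R 0 u u
  step : ∀ {k u w v} → R u w → WalkN R k w v → WalkN R (Data.Nat.suc k) u v

InducedEdge : (G : Graph) → (Vtx G → Set) → Vtx G → Vtx G → Set
InducedEdge G P u v = P u × P v × Edge G u v

-- |S| ≤ k for a subset S of the (finite) vertex set:
-- every duplicate-free list of elements of S has length ≤ k.
CardLe : {A : Set} → (A → Set) → ℕ → Set
CardLe {A} S k = (xs : List A) → Unique xs → All S xs → length xs ≤ k

-- K_t minor via a model: disjoint nonempty connected branch sets, pairwise adjacent.
-- β v ≡ just i  means v lies in branch set i.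
HasKMinor : (t : ℕ) → Graph → Set
HasKMinor t G = Σ (Vtx G → Maybe (Fin t)) λ β →
    (∀ i → ∃ λ v → β v ≡ just i)
  × (∀ i u v → β u ≡ just i → β v ≡ just i →
       Walk (InducedEdge G (λ x → β x ≡ just i)) u v)
  × (∀ i j → i ≢ j → ∃ λ u → ∃ λ v → β u ≡ just i × β v ≡ just j × Edge G u v)

-- A decomposition (H_1,…,H_ℓ) of G (indexed 0,…,ℓ-1): the vertex sets are given by
-- the assignment `part` (so they partition V(G)); edges of H_i are given by `E i`.
record Decomposition (G : Graph) : Set₁ where
  field
    ℓ       : ℕ
    part    : Vtx G → Fin ℓ
    E       : Fin ℓ → Vtx G → Vtx G → Set
    E-sub   : ∀ i u v → E i u v → Edge G u v × part u ≡ i × part v ≡ i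
    nonempty : ∀ i → ∃ λ v → part v ≡ i

open Decomposition public

InH : {G : Graph} (D : Decomposition G) → Fin (ℓ D) → Vtx G → Set
InH D i v = part D v ≡ i

-- vertices of G - ⋃_{j<i} V(H_j)
Remaining : {G : Graph} (D : Decomposition G) → Fin (ℓ D) → Vtx G → Set
Remaining D i v = toℕ i ≤ toℕ (part D v)

Connected : {G : Graph} (D : Decomposition G) → Set
Connected D = ∀ i u v → InH D i u → InH D i v → Walk (E D i) u v

DistLe : (G : Graph) → (Vtx G → Set) → Vtx G → Vtx G → ℕ → Set
DistLe G P v w r = P v × ∃ λ k → k ≤ r × WalkN (InducedEdge G P) k v w

Spreads : (G : Graph) → (P S : Vtx G → Set) → (ℕ → ℕ) → Set
Spreads G P S f = ∀ r v → P v → CardLe (λ w → DistLe G P v w r × S w) (f r)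

Flat : {G : Graph} → (ℕ → ℕ) → Decomposition G → Set
Flat {G} f D = ∀ i → Spreads G (Remaining D i) (InH D i) f

-- Width ≤ k: for every i and every component C of G - ⋃_{j<i} V(H_j)
-- (C represented as the set of vertices reachable from some v in that graph),
-- the number of j < i such that some edge of G joins H_j and C is at most k.
WidthLe : {G : Graph} → Decomposition G → ℕ → Set
WidthLe {G} D k = ∀ i v → Remaining D i v →
  CardLe (λ j → toℕ j < toℕ i × ∃ λ u → ∃ λ w →
            InH D j u × Walk (InducedEdge G (Remaining D i)) v w × Edge G u w) k

fₜ : ℕ → ℕ → ℕ
fₜ t r = (t ∸ 3) * (2 * r + 1)

-- The parts are chosen greedily and recorded by a labelling lab : V → ℕ
-- (part i = {x | lab x ≡ i} for i < c).  Invariant: the parts are nonempty,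
-- connected, spread on the graph left when they were chosen, and two parts
-- touching a common component of a remainder are adjacent; so a component
-- touching t-1 parts would give a K_t model, which bounds the width.  A new
-- part is the union of at most t-3 geodesics of the remainder from a common
-- root, reaching the (at most t-2) parts touching one component; it spreads
-- with f because a geodesic meets a ball of radius r in at most 2r+1 vertices.

module Submission where

open import Defs renaming (sym to adj-sym)
open import Data.Nat using (ℕ; zero; suc; _≤_; _<_; _∸_; _+_; _*_; z≤n; s≤s; s≤s⁻¹; _≤?_; _<?_)
open import Data.Nat.Properties
open import Data.Nat.Induction using (<-rec)
open import Data.Fin using (Fin; toℕ; fromℕ<) renaming (zero to fzero; suc to fsuc)
open import Data.Fin.Properties using (any?; toℕ<n; toℕ-fromℕ<; toℕ-injective) renaming (_≟_ to _≟ᶠ_)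
open import Data.Bool using (T)
open import Data.Bool.Properties using (T?)
open import Data.Maybe using (Maybe; just; nothing)
open import Data.List using (List; []; _∷_; _++_; length; filter; take; concat; map; lookup; allFin; upTo)
open import Data.List.Properties using (filter-notAll; length-take; length-map; length-tabulate)
open import Data.List.Relation.Unary.All as All using (All; []; _∷_)
open import Data.List.Relation.Unary.All.Properties using () renaming (map⁺ to All-map⁺)
open import Data.List.Relation.Unary.Any as Any using (here; there; index)
open import Data.List.Relation.Unary.Any.Properties using (lookup-index)
open import Data.List.Relation.Unary.Unique.Propositional using (Unique)
open import Data.List.Relation.Unary.Unique.Propositional.Properties using (filter⁺; take⁺; upTo⁺) renaming (map⁺ to Unique-map⁺)
open import Data.List.Relation.Unary.AllPairs using ([]; _∷_)
open import Data.List.Membership.Propositional using (_∈_; _∉_)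
open import Data.List.Membership.Propositional.Properties using (∈-filter⁺; ∈-filter⁻; ∈-++⁺ˡ; ∈-++⁺ʳ; ∈-++⁻; ∈-allFin; ∈-lookup; ∈-upTo⁺; ∈-upTo⁻)
open import Data.Product using (Σ; ∃; _×_; _,_; proj₁; proj₂)
open import Data.Sum using (_⊎_; inj₁; inj₂; [_,_]′)
open import Data.Empty using (⊥-elim)
open import Function using (_∘_; id)
open import Relation.Binary.Definitions using (DecidableEquality)
open import Relation.Binary.PropositionalEquality using (_≡_; _≢_; refl; sym; trans; cong; subst; subst₂)
open import Relation.Nullary using (¬_; Dec; yes; no; ¬?)
open import Relation.Nullary.Decidable using (_×-dec_)
open import Relation.Unary using (Decidable)

CardLe-⊆ : ∀ {A : Set} {S S' : A → Set} {k} → (∀ {x} → S x → S' x) → CardLe S' k → CardLe S k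
CardLe-⊆ S⊆S' bound xs distinct inS = bound xs distinct (All.map S⊆S' inS)

length-≤-split : ∀ {A : Set} {Q : A → Set} (Q? : Decidable Q) (xs : List A) →
  length xs ≤ length (filter Q? xs) + length (filter (¬? ∘ Q?) xs)
length-≤-split Q? [] = z≤n
length-≤-split Q? (x ∷ xs) with Q? x
... | yes _ = s≤s (length-≤-split Q? xs)
... | no _  = ≤-trans (s≤s (length-≤-split Q? xs)) (≤-reflexive (sym (+-suc _ _)))

CardLe-split : ∀ {A : Set} {S Q : A → Set} {a b} → Decidable Q →
  CardLe (λ x → S x × Q x) a → CardLe (λ x → S x × ¬ Q x) b → CardLe S (a + b)
CardLe-split {S = S} Q? boundQ bound¬Q xs distinct inS =
  ≤-trans (length-≤-split Q? xs)
    (+-mono-≤ (boundQ _ (filter⁺ Q? distinct) (selected Q?))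
              (bound¬Q _ (filter⁺ (¬? ∘ Q?) distinct) (selected (¬? ∘ Q?))))
  where
  selected : ∀ {Q'} (Q'? : Decidable Q') → All (λ x → S x × Q' x) (filter Q'? xs)
  selected Q'? = All.tabulate λ x∈ → let (x∈xs , q) = ∈-filter⁻ Q'? x∈ in All.lookup inS x∈xs , q

position : ∀ {A : Set} {x : A} {ys} → x ∈ ys → ℕ
position = toℕ ∘ index

Window : ∀ {A : Set} → (A → Set) → ℕ → List A → Set
Window B d ys = ∀ {x y} (x∈ : x ∈ ys) (y∈ : y ∈ ys) → B x → B y →
  position x∈ ≤ position y∈ → position y∈ ≤ position x∈ + d

∈-take⁺ : ∀ {A : Set} {x : A} k (ys : List A) (x∈ : x ∈ ys) → position x∈ < k → x ∈ take k ys
∈-take⁺ (suc k) (y ∷ ys) (here eq) _ = here eq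
∈-take⁺ (suc k) (y ∷ ys) (there x∈) (s≤s lt) = there (∈-take⁺ k ys x∈ lt)

∈-take⁻ : ∀ {A : Set} {x : A} k (ys : List A) → x ∈ take k ys → x ∈ ys
∈-take⁻ (suc k) (y ∷ ys) (here eq) = here eq
∈-take⁻ (suc k) (y ∷ ys) (there x∈) = there (∈-take⁻ k ys x∈)

lookup-injective : ∀ {A : Set} {ys : List A} → Unique ys → ∀ i j → lookup ys i ≡ lookup ys j → i ≡ j
lookup-injective {ys = y ∷ ys} (_ ∷ _) fzero fzero _ = refl
lookup-injective {ys = y ∷ ys} (y∉ ∷ _) fzero (fsuc j) eq = ⊥-elim (All.lookup y∉ (∈-lookup j) eq)
lookup-injective {ys = y ∷ ys} (y∉ ∷ _) (fsuc i) fzero eq = ⊥-elim (All.lookup y∉ (∈-lookup i) (sym eq))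
lookup-injective {ys = y ∷ ys} (_ ∷ distinct) (fsuc i) (fsuc j) eq = cong fsuc (lookup-injective distinct i j eq)

module Counting {A : Set} (_≟_ : DecidableEquality A) where
  open import Data.List.Membership.DecPropositional _≟_ using (_∈?_)

  pigeonhole : (ys : List A) → CardLe (_∈ ys) (length ys)
  pigeonhole ys [] _ _ = z≤n
  pigeonhole ys (x ∷ xs) (x∉xs ∷ distinct) (x∈ys ∷ xs⊆ys) =
    ≤-trans (s≤s (pigeonhole (filter ≢x? ys) xs distinct
                   (All.zipWith (λ { (x≢z , z∈ys) → ∈-filter⁺ ≢x? z∈ys (x≢z ∘ sym) }) (x∉xs , xs⊆ys))))
            (filter-notAll ≢x? ys (Any.map (λ x≡y y≢x → y≢x (sym x≡y)) x∈ys))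
    where
    ≢x? : Decidable (λ y → ¬ y ≡ x)
    ≢x? y = ¬? (y ≟ x)

  -- B-members of ys inside a window of width d are at most d+1 many: if the
  -- first element is one of them, all of them lie among the first d+1.
  window-bound : ∀ (B : A → Set) d ys → Window B d ys → CardLe (λ x → x ∈ ys × B x) (suc d)
  window-bound B d [] _ [] _ _ = z≤n
  window-bound B d [] _ (x ∷ xs) _ ((() , _) ∷ _)
  window-bound B d (y ∷ ys) window xs distinct inB with y ∈? xs
  ... | yes y∈xs = ≤-trans (pigeonhole (take (suc d) (y ∷ ys)) xs distinct inPrefix)
                           (≤-trans (≤-reflexive (length-take (suc d) (y ∷ ys))) (m⊓n≤m (suc d) _))
    where
    By : B y
    By = proj₂ (All.lookup inB y∈xs)
    inPrefix : All (_∈ take (suc d) (y ∷ ys)) xs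
    inPrefix = All.map (λ { (x∈ , Bx) → ∈-take⁺ (suc d) (y ∷ ys) x∈ (s≤s (window (here refl) x∈ By Bx z≤n)) }) inB
  ... | no y∉xs = window-bound B d ys window' xs distinct (All.tabulate λ x∈xs → dropHead x∈xs (All.lookup inB x∈xs))
    where
    window' : Window B d ys
    window' x∈ y∈ Bx By le = s≤s⁻¹ (window (there x∈) (there y∈) Bx By (s≤s le))
    dropHead : ∀ {x} → x ∈ xs → x ∈ y ∷ ys × B x → x ∈ ys × B x
    dropHead x∈xs (here refl , _) = ⊥-elim (y∉xs x∈xs)
    dropHead x∈xs (there x∈ys , Bx) = x∈ys , Bx

  concat-bound : ∀ (B : A → Set) e (yss : List (List A)) →
    All (λ ys → CardLe (λ x → x ∈ ys × B x) e) yss → CardLe (λ x → x ∈ concat yss × B x) (length yss * e)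
  concat-bound B e [] [] [] _ _ = z≤n
  concat-bound B e [] [] (x ∷ xs) _ ((() , _) ∷ _)
  concat-bound B e (ys ∷ yss) (bound ∷ bounds) =
    CardLe-split (_∈? ys)
      (CardLe-⊆ (λ { ((_ , Bx) , x∈ys) → x∈ys , Bx }) bound)
      (CardLe-⊆ (λ { ((x∈ , Bx) , x∉ys) → inRest x∈ x∉ys , Bx }) (concat-bound B e yss bounds))
    where
    inRest : ∀ {x} → x ∈ ys ++ concat yss → x ∉ ys → x ∈ concat yss
    inRest x∈ x∉ys = [ (λ x∈ys → ⊥-elim (x∉ys x∈ys)) , id ]′ (∈-++⁻ ys x∈)

Fin-pigeonhole : ∀ {N} (xs : List (Fin N)) → Unique xs → length xs ≤ N
Fin-pigeonhole {N} xs distinct = subst (length xs ≤_) (length-tabulate {n = N} id)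
  (Counting.pigeonhole _≟ᶠ_ (allFin N) xs distinct (All.tabulate λ {x} _ → ∈-allFin x))

mapWalk : ∀ {A : Set} {R R' : A → A → Set} → (∀ {a b} → R a b → R' a b) →
  ∀ {u v} → Walk R u v → Walk R' u v
mapWalk f here = here
mapWalk f (step e w) = step (f e) (mapWalk f w)

mapWalkN : ∀ {A : Set} {R R' : A → A → Set} → (∀ {a b} → R a b → R' a b) →
  ∀ {k u v} → WalkN R k u v → WalkN R' k u v
mapWalkN f here = here
mapWalkN f (step e w) = step (f e) (mapWalkN f w)

module Walks {A : Set} {R : A → A → Set} where

  forget : ∀ {k u v} → WalkN R k u v → Walk R u v
  forget here = here
  forget (step e w) = step e (forget w)

  measure : ∀ {u v} → Walk R u v → ∃ λ k → WalkN R k u v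
  measure here = 0 , here
  measure (step e w) = let (k , w') = measure w in suc k , step e w'

  _++ʷ_ : ∀ {u v w} → Walk R u v → Walk R v w → Walk R u w
  here ++ʷ q = q
  step e p ++ʷ q = step e (p ++ʷ q)

  _++ⁿ_ : ∀ {k j u v w} → WalkN R k u v → WalkN R j v w → WalkN R (k + j) u w
  here ++ⁿ q = q
  step e p ++ⁿ q = step e (p ++ⁿ q)

  snocⁿ : ∀ {k u v w} → WalkN R k u v → R v w → WalkN R (suc k) u w
  snocⁿ here e = step e here
  snocⁿ (step e' p) e = step e' (snocⁿ p e)

  module _ (R-sym : ∀ {a b} → R a b → R b a) where
    reverseⁿ : ∀ {k u v} → WalkN R k u v → WalkN R k v u
    reverseⁿ here = here
    reverseⁿ (step e w) = snocⁿ (reverseⁿ w) (R-sym e)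

    reverseʷ : ∀ {u v} → Walk R u v → Walk R v u
    reverseʷ w = forget (reverseⁿ (proj₂ (measure w)))

  vertices : ∀ {k u v} → WalkN R k u v → List A
  vertices {u = u} here = u ∷ []
  vertices (step {u = u} e w) = u ∷ vertices w

  length-vertices : ∀ {k u v} (w : WalkN R k u v) → length (vertices w) ≡ suc k
  length-vertices here = refl
  length-vertices (step e w) = cong suc (length-vertices w)

  first∈ : ∀ {k u v} (w : WalkN R k u v) → u ∈ vertices w
  first∈ here = here refl
  first∈ (step e w) = here refl

  last∈ : ∀ {k u v} (w : WalkN R k u v) → v ∈ vertices w
  last∈ here = here refl
  last∈ (step e w) = there (last∈ w)

  cut : ∀ {k u v x} (w : WalkN R k u v) (x∈ : x ∈ vertices w) →
    WalkN R (position x∈) u x × WalkN R (k ∸ position x∈) x v × position x∈ ≤ k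
  cut here (here refl) = here , here , z≤n
  cut (step e w) (here refl) = here , step e w , z≤n
  cut (step e w) (there x∈) = let (pre , suf , bound) = cut w x∈ in step e pre , suf , s≤s bound

  prefixWithin : ∀ {k u v x} (w : WalkN R k u v) → x ∈ vertices w →
    Walk (λ a b → a ∈ vertices w × b ∈ vertices w × R a b) u x
  prefixWithin here (here refl) = here
  prefixWithin (step e w) (here refl) = here
  prefixWithin (step e w) (there x∈) =
    step (here refl , there (first∈ w) , e) (mapWalk (λ { (a∈ , b∈ , r) → there a∈ , there b∈ , r }) (prefixWithin w x∈))

  suffixFrom : ∀ {k u v x} (w : WalkN R k u v) → x ∈ vertices w →
    ∃ λ k' → Σ (WalkN R k' x v) λ w' → Unique (vertices w) → Unique (vertices w')
  suffixFrom here (here refl) = 0 , here , id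
  suffixFrom (step e w) (here refl) = _ , step e w , id
  suffixFrom (step e w) (there x∈) =
    let (k' , w' , keeps) = suffixFrom w x∈ in k' , w' , λ { (_ ∷ distinct) → keeps distinct }

  -- Every walk can be shortened to a path (a walk with distinct vertices):
  -- a repeated start vertex is removed by jumping to its later occurrence.
  toPath : DecidableEquality A → ∀ {k u v} → WalkN R k u v → ∃ λ k' → Σ (WalkN R k' u v) (Unique ∘ vertices)
  toPath _≟_ here = 0 , here , [] ∷ []
  toPath _≟_ (step {u = u} e w) with toPath _≟_ w
  ... | k' , path , distinct with Any.any? (u ≟_) (vertices path)
  ... | yes u∈ = let (k'' , path' , keeps) = suffixFrom path u∈ in k'' , path' , keeps distinct
  ... | no u∉ = suc k' , step e path , All.tabulate (λ {x} x∈ u≡x → u∉ (subst (_∈ vertices path) (sym u≡x) x∈)) ∷ distinct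

open Walks

-- On a finite vertex set with decidable edges, reachability is decidable:
-- a walk can be shortened to fewer edges than vertices, and walks of each
-- fixed length can be searched exhaustively.
module FiniteWalks {N : ℕ} {R : Fin N → Fin N → Set} (R? : ∀ a b → Dec (R a b)) where

  walkN? : ∀ k u x → Dec (WalkN R k u x)
  walkN? zero u x with u ≟ᶠ x
  ... | yes refl = yes here
  ... | no u≢x = no λ { here → u≢x refl }
  walkN? (suc k) u x with any? (λ y → R? u y ×-dec walkN? k y x)
  ... | yes (y , e , w) = yes (step e w)
  ... | no none = no λ { (step e w) → none (_ , e , w) }

  -- a path visits distinct vertices, so it has fewer than N edges
  short-walk : ∀ {k u v} → WalkN R k u v → ∃ λ k' → k' < N × WalkN R k' u v
  short-walk w = let (k' , path , distinct) = toPath _≟ᶠ_ w in k' , bound path distinct , path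
    where
    bound : ∀ {k' u v} (path : WalkN R k' u v) → Unique (vertices path) → suc k' ≤ N
    bound path distinct = subst (_≤ N) (length-vertices path) (Fin-pigeonhole (vertices path) distinct)

  walk? : ∀ u x → Dec (Walk R u x)
  walk? u x with any? {n = N} (λ i → walkN? (toℕ i) u x)
  ... | yes (_ , w) = yes (forget w)
  ... | no none = no λ w → let (k , k<N , w') = short-walk (proj₂ (measure w)) in
      none (fromℕ< k<N , subst (λ m → WalkN R m u x) (sym (toℕ-fromℕ< k<N)) w')

Least : (ℕ → Set) → Set
Least Q = Σ ℕ λ m → Q m × (∀ {k} → Q k → m ≤ k)

-- A decidable property that holds somewhere has a least witness: search
-- below the known witness, and recurse on any smaller one found.
least : ∀ {Q : ℕ → Set} → Decidable Q → ∀ {m} → Q m → Least Q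
least {Q} Q? {m} = <-rec (λ m → Q m → Least Q) search m
  where
  search : ∀ m → (∀ {k} → k < m → Q k → Least Q) → Q m → Least Q
  search m smaller qm with any? {n = m} (λ i → Q? (toℕ i))
  ... | yes (i , qi) = smaller (toℕ<n i) qi
  ... | no none = m , qm , λ {k} qk → ≮⇒≥ λ k<m → none (fromℕ< k<m , subst Q (sym (toℕ-fromℕ< k<m)) qk)

module Construction (G : Graph) where

  N : ℕ
  N = n G

  V : Set
  V = Vtx G

  IE : (V → Set) → V → V → Set
  IE = InducedEdge G

  edge-sym : ∀ {u v} → Edge G u v → Edge G v u
  edge-sym {u} {v} = subst T (adj-sym G u v)

  IE-sym : ∀ {P a b} → IE P a b → IE P b a
  IE-sym (a∈P , b∈P , e) = b∈P , a∈P , edge-sym e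

  IE-map : ∀ {P Q : V → Set} → (∀ {x} → P x → Q x) → ∀ {a b} → IE P a b → IE Q a b
  IE-map P⊆Q (a∈P , b∈P , e) = P⊆Q a∈P , P⊆Q b∈P , e

  along : ∀ {P u v} → Walk (IE P) u v → P u → P v
  along here u∈P = u∈P
  along (step (_ , w∈P , _) w) _ = along w w∈P

  edge? : ∀ u v → Dec (Edge G u v)
  edge? u v = T? (adj G u v)

  IE? : ∀ {P} → Decidable P → ∀ a b → Dec (IE P a b)
  IE? P? a b = P? a ×-dec (P? b ×-dec edge? a b)

  reachable? : ∀ {P} → Decidable P → ∀ u x → Dec (Walk (IE P) u x)
  reachable? P? = FiniteWalks.walk? (IE? P?)

  Component : (V → Set) → V → V → Set
  Component P v x = Walk (IE P) v x

  component-connected : ∀ {P v x y} → Component P v x → Component P v y → Walk (IE (Component P v)) x y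
  component-connected {P} {v} v⇝x v⇝y = inside v⇝x (reverseʷ IE-sym v⇝x ++ʷ v⇝y)
    where
    inside : ∀ {u z} → Component P v u → Walk (IE P) u z → Walk (IE (Component P v)) u z
    inside v⇝u here = here
    inside v⇝u (step e w) = step (v⇝u , v⇝u ++ʷ step e here , proj₂ (proj₂ e)) (inside (v⇝u ++ʷ step e here) w)

  spreads-cong : ∀ {P Q S S' : V → Set} {f} → (∀ {x} → Q x → P x) → (∀ {x} → P x → Q x) →
    (∀ {x} → S' x → S x) → Spreads G P S f → Spreads G Q S' f
  spreads-cong Q⊆P P⊆Q S'⊆S spreads r v v∈Q =
    CardLe-⊆ (λ { ((_ , d , d≤r , w) , x∈S') → (Q⊆P v∈Q , d , d≤r , mapWalkN (IE-map Q⊆P) w) , S'⊆S x∈S' })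
             (spreads r v (Q⊆P v∈Q))

  record Geodesic (P T : V → Set) (root : V) : Set where
    field
      len : ℕ
      end : V
      end∈T : T end
      path : WalkN (IE P) len root end
      shortest : ∀ {k z} → T z → WalkN (IE P) k root z → len ≤ k

  open Geodesic

  geodesic : ∀ {P T : V → Set} → Decidable P → Decidable T → ∀ {root z} → T z → Walk (IE P) root z → Geodesic P T root
  geodesic {P} {T} P? T? {root} z∈T w with least reaches? (_ , z∈T , proj₂ (measure w))
    where
    reaches? : Decidable (λ k → ∃ λ z → T z × WalkN (IE P) k root z)
    reaches? k = any? (λ z → T? z ×-dec FiniteWalks.walkN? (IE? P?) k root z)
  ... | m , (z , z∈T , w) , minimal = record
    { len = m ; end = z ; end∈T = z∈T ; path = w ; shortest = λ z'∈T w' → minimal (_ , z'∈T , w') }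

  shortcut-bound : ∀ a b m s → b ≤ m → m ≤ a + (s + (m ∸ b)) → b ≤ a + s
  shortcut-bound a b m s b≤m le =
    subst₂ _≤_ (m∸[m∸n]≡n b≤m) (m+n∸n≡m (a + s) (m ∸ b))
      (∸-monoˡ-≤ (m ∸ b) (subst (m ≤_) (sym (+-assoc a s (m ∸ b))) le))

  -- Two vertices of a geodesic within distance r of c are at most 2r apart
  -- along it, for otherwise the detour through c would be shorter.
  geodesic-window : ∀ {P T root} (g : Geodesic P T root) c r →
    Window (λ x → DistLe G P c x r) (r + r) (vertices (path g))
  geodesic-window g c r x∈ y∈ (_ , k₁ , k₁≤r , c⇝x) (_ , k₂ , k₂≤r , c⇝y) a≤b =
    ≤-trans (shortcut-bound a b (len g) (k₁ + k₂) b≤m (subst (λ e → len g ≤ a + e) (sym (+-assoc k₁ k₂ _)) detour))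
            (+-monoʳ-≤ a (+-mono-≤ k₁≤r k₂≤r))
    where
    a = position x∈
    b = position y∈
    b≤m = proj₂ (proj₂ (cut (path g) y∈))
    detour : len g ≤ a + (k₁ + (k₂ + (len g ∸ b)))
    detour = shortest g (end∈T g)
      (proj₁ (cut (path g) x∈) ++ⁿ (reverseⁿ IE-sym c⇝x ++ⁿ (c⇝y ++ⁿ proj₁ (proj₂ (cut (path g) y∈)))))

  geodesic-ball : ∀ {P T root} (g : Geodesic P T root) c r →
    CardLe (λ x → x ∈ vertices (path g) × DistLe G P c x r) (suc (r + r))
  geodesic-ball g c r = Counting.window-bound _≟ᶠ_ _ (r + r) (vertices (path g)) (geodesic-window g c r)

  record Spoke (P : V → Set) (root : V) : Set₁ where
    field
      target : V → Set
      geo : Geodesic P target root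

  open Spoke

  spokeVertices : ∀ {P root} → Spoke P root → List V
  spokeVertices s = vertices (path (geo s))

  hull : ∀ {P root} → List (Spoke P root) → List V
  hull ss = concat (map spokeVertices ss)

  root∈hull : ∀ {P root} (s : Spoke P root) ss → root ∈ hull (s ∷ ss)
  root∈hull s ss = ∈-++⁺ˡ (first∈ (path (geo s)))

  hull⊆ : ∀ {P root} (ss : List (Spoke P root)) → P root → ∀ {x} → x ∈ hull ss → P x
  hull⊆ (s ∷ ss) root∈P x∈ with ∈-++⁻ (spokeVertices s) x∈
  ... | inj₁ x∈s = along (forget (proj₁ (cut (path (geo s)) x∈s))) root∈P
  ... | inj₂ x∈ss = hull⊆ ss root∈P x∈ss

  hull-connected : ∀ {P root} (ss : List (Spoke P root)) → ∀ {x} → x ∈ hull ss → Walk (IE (_∈ hull ss)) root x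
  hull-connected (s ∷ ss) x∈ with ∈-++⁻ (spokeVertices s) x∈
  ... | inj₁ x∈s = mapWalk (λ { (a∈ , b∈ , (_ , _ , e)) → ∈-++⁺ˡ a∈ , ∈-++⁺ˡ b∈ , e }) (prefixWithin (path (geo s)) x∈s)
  ... | inj₂ x∈ss = mapWalk (IE-map (∈-++⁺ʳ (spokeVertices s))) (hull-connected ss x∈ss)

  hull-spreads : ∀ {P root m} (ss : List (Spoke P root)) → length ss ≤ m → Spreads G P (_∈ hull ss) (λ r → m * (2 * r + 1))
  hull-spreads {P} {m = m} ss few r c _ xs distinct inS =
    ≤-trans (Counting.concat-bound _≟ᶠ_ _ (suc (r + r)) (map spokeVertices ss) (balls ss) xs distinct
               (All.map (λ { (d , x∈) → x∈ , d }) inS))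
            (subst₂ _≤_ (cong (_* suc (r + r)) (sym (length-map spokeVertices ss))) (cong (m *_) double)
               (*-monoˡ-≤ (suc (r + r)) few))
    where
    balls : ∀ ss → All (λ ys → CardLe (λ x → x ∈ ys × DistLe G P c x r) (suc (r + r))) (map spokeVertices ss)
    balls [] = []
    balls (s ∷ ss) = geodesic-ball (geo s) c r ∷ balls ss
    double : suc (r + r) ≡ 2 * r + 1
    double = trans (cong (λ s → suc (r + s)) (sym (+-identityʳ r))) (+-comm 1 (2 * r))

  Rest : ℕ → (V → ℕ) → V → Set
  Rest i lab x = i ≤ lab x

  Touches : (V → ℕ) → ℕ → V → ℕ → Set
  Touches lab i v j = ∃ λ u → ∃ λ w → lab u ≡ j × Walk (IE (Rest i lab)) v w × Edge G u w

  Adjacent : (V → ℕ) → ℕ → ℕ → Set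
  Adjacent lab j j' = ∃ λ a → ∃ λ b → lab a ≡ j × lab b ≡ j' × Edge G a b

  Adjacent-sym : ∀ {lab j j'} → Adjacent lab j j' → Adjacent lab j' j
  Adjacent-sym (a , b , la , lb , e) = b , a , lb , la , edge-sym e

  TouchingAdjacent : (V → ℕ) → ℕ → Set
  TouchingAdjacent lab i = ∀ {v j j'} → Rest i lab v → j < i → j' < i → j ≢ j' →
    Touches lab i v j → Touches lab i v j' → Adjacent lab j j'

  -- A connected set C, adjacent to each of m pairwise adjacent connected
  -- parts disjoint from it, yields a K_{m+1} model: branch set 0 is C and
  -- branch set 1+i is the part js[i].
  module CliqueMinor (lab : V → ℕ) (js : List ℕ) (js-distinct : Unique js)
    (part-nonempty : ∀ {j} → j ∈ js → ∃ λ u → lab u ≡ j)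
    (part-connected : ∀ {j} → j ∈ js → ∀ {u v} → lab u ≡ j → lab v ≡ j → Walk (IE (λ x → lab x ≡ j)) u v)
    (parts-adjacent : ∀ {j j'} → j ∈ js → j' ∈ js → j ≢ j' → Adjacent lab j j')
    (C : V → Set) (C? : Decidable C) {c₀ : V} (c₀∈C : C c₀)
    (C-connected : ∀ {x y} → C x → C y → Walk (IE C) x y)
    (C-disjoint : ∀ {x} → C x → lab x ∉ js)
    (C-adjacent : ∀ {j} → j ∈ js → ∃ λ a → ∃ λ b → lab a ≡ j × C b × Edge G a b) where

    open import Data.List.Membership.DecPropositional _≟_ using (_∈?_)

    classify : ∀ {x} → Dec (C x) → Dec (lab x ∈ js) → Maybe (Fin (suc (length js)))
    classify (yes _) _ = just fzero
    classify (no _) (yes j∈) = just (fsuc (index j∈))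
    classify (no _) (no _) = nothing

    branch : V → Maybe (Fin (suc (length js)))
    branch x = classify (C? x) (lab x ∈? js)

    branch-C⇒ : ∀ {x} → branch x ≡ just fzero → C x
    branch-C⇒ {x} eq with C? x | lab x ∈? js
    ... | yes x∈C | _ = x∈C
    ... | no _ | yes _ with () ← eq
    ... | no _ | no _ with () ← eq

    branch-C⇐ : ∀ {x} → C x → branch x ≡ just fzero
    branch-C⇐ {x} x∈C with C? x
    ... | yes _ = refl
    ... | no x∉C = ⊥-elim (x∉C x∈C)

    branch-part⇒ : ∀ {x i} → branch x ≡ just (fsuc i) → lab x ≡ lookup js i
    branch-part⇒ {x} eq with C? x | lab x ∈? js
    ... | yes _ | _ with () ← eq
    ... | no _ | yes j∈ with refl ← eq = lookup-index j∈
    ... | no _ | no _ with () ← eq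

    branch-part⇐ : ∀ {x i} → lab x ≡ lookup js i → branch x ≡ just (fsuc i)
    branch-part⇐ {x} {i} eq with C? x | lab x ∈? js
    ... | yes x∈C | _ = ⊥-elim (C-disjoint x∈C (subst (_∈ js) (sym eq) (∈-lookup i)))
    ... | no _ | yes j∈ = cong (just ∘ fsuc) (lookup-injective js-distinct (index j∈) i (trans (sym (lookup-index j∈)) eq))
    ... | no _ | no j∉ = ⊥-elim (j∉ (subst (_∈ js) (sym eq) (∈-lookup i)))

    model : HasKMinor (suc (length js)) G
    model = branch , branch-nonempty , branch-connected , branch-adjacent
      where
      branch-nonempty : ∀ i → ∃ λ v → branch v ≡ just i
      branch-nonempty fzero = c₀ , branch-C⇐ c₀∈C
      branch-nonempty (fsuc i) = let (u , lu) = part-nonempty (∈-lookup i) in u , branch-part⇐ lu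

      branch-connected : ∀ i u v → branch u ≡ just i → branch v ≡ just i → Walk (IE (λ x → branch x ≡ just i)) u v
      branch-connected fzero u v bu bv = mapWalk (IE-map branch-C⇐) (C-connected (branch-C⇒ bu) (branch-C⇒ bv))
      branch-connected (fsuc i) u v bu bv =
        mapWalk (IE-map branch-part⇐) (part-connected (∈-lookup i) (branch-part⇒ bu) (branch-part⇒ bv))

      branch-adjacent : ∀ i j → i ≢ j → ∃ λ u → ∃ λ v → branch u ≡ just i × branch v ≡ just j × Edge G u v
      branch-adjacent fzero fzero i≢j = ⊥-elim (i≢j refl)
      branch-adjacent fzero (fsuc j) _ =
        let (a , b , la , b∈C , e) = C-adjacent (∈-lookup j) in b , a , branch-C⇐ b∈C , branch-part⇐ la , edge-sym e
      branch-adjacent (fsuc i) fzero _ =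
        let (a , b , la , b∈C , e) = C-adjacent (∈-lookup i) in a , b , branch-part⇐ la , branch-C⇐ b∈C , e
      branch-adjacent (fsuc i) (fsuc j) i≢j =
        let (a , b , la , lb , e) = parts-adjacent (∈-lookup i) (∈-lookup j) (i≢j ∘ cong fsuc ∘ lookup-injective js-distinct i j)
        in a , b , branch-part⇐ la , branch-part⇐ lb , e

  module Greedy (k : ℕ) where

    t : ℕ
    t = 4 + k

    record Invariant (c : ℕ) (lab : V → ℕ) : Set where
      field
        part-nonempty : ∀ {i} → i < c → ∃ λ v → lab v ≡ i
        part-connected : ∀ {i} → i < c → ∀ {u v} → lab u ≡ i → lab v ≡ i → Walk (IE (λ x → lab x ≡ i)) u v
        part-spreads : ∀ {i} → i < c → Spreads G (Rest i lab) (λ x → lab x ≡ i) (fₜ t)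
        touching-adjacent : ∀ {i} → i ≤ c → TouchingAdjacent lab i

    invariant₀ : Invariant 0 (λ _ → 0)
    invariant₀ = record
      { part-nonempty = λ () ; part-connected = λ () ; part-spreads = λ ()
      ; touching-adjacent = λ { z≤n _ () } }

    -- The parts are nonempty and disjoint, so there are at most N of them.
    parts-bound : ∀ {c lab} → Invariant c lab → c ≤ N
    parts-bound {c} {lab} inv =
      let (xs , length-xs , distinct , _) = representatives c ≤-refl in
      subst (_≤ N) length-xs (Fin-pigeonhole xs distinct)
      where
      open Invariant inv
      representatives : ∀ m → m ≤ c → Σ (List V) λ xs → length xs ≡ m × Unique xs × All (λ x → lab x < m) xs
      representatives zero _ = [] , refl , [] , []
      representatives (suc m) m<c =
        let (r , lr) = part-nonempty m<c
            (xs , length-xs , distinct , below) = representatives m (<⇒≤ m<c)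
        in r ∷ xs , cong suc length-xs ,
           All.map (λ lx<m r≡x → <⇒≢ lx<m (trans (cong lab (sym r≡x)) lr)) below ∷ distinct ,
           ≤-reflexive (cong suc lr) ∷ All.map m<n⇒m<1+n below

    module _ (noK : ¬ HasKMinor t G) where

      -- Width: a component of G[Rest i lab] touches at most t-2 parts below i;
      -- otherwise it would form, with t-1 of these pairwise adjacent parts, a
      -- K_t model.
      width-bound : ∀ {c lab i v} → Invariant c lab → i ≤ c → Rest i lab v →
        CardLe (λ j → j < i × Touches lab i v j) (2 + k)
      width-bound {c} {lab} {i} {v} inv i≤c v∈Rest js distinct touching with length js ≤? 2 + k
      ... | yes few = few
      ... | no many = ⊥-elim (noK (subst (λ m → HasKMinor m G) size model))
        where
        open Invariant inv
        js' : List ℕ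
        js' = take (3 + k) js
        size : suc (length js') ≡ t
        size = cong suc (trans (length-take (3 + k) js) (m≤n⇒m⊓n≡m (≰⇒> many)))
        touching' : ∀ {j} → j ∈ js' → j < i × Touches lab i v j
        touching' j∈ = All.lookup touching (∈-take⁻ (3 + k) js j∈)
        below-c : ∀ {j} → j ∈ js' → j < c
        below-c j∈ = ≤-trans (proj₁ (touching' j∈)) i≤c
        open CliqueMinor lab js' (take⁺ (3 + k) distinct)
          (part-nonempty ∘ below-c) (part-connected ∘ below-c)
          (λ j∈ j'∈ j≢j' → touching-adjacent i≤c v∈Rest (proj₁ (touching' j∈)) (proj₁ (touching' j'∈)) j≢j'
                             (proj₂ (touching' j∈)) (proj₂ (touching' j'∈)))
          (Component (Rest i lab) v) (reachable? (λ x → i ≤? lab x) v) here component-connected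
          (λ v⇝x lx∈ → <⇒≱ (proj₁ (touching' lx∈)) (along v⇝x v∈Rest))
          (proj₂ ∘ touching')

      module Extension {c : ℕ} {lab : V → ℕ} (inv : Invariant c lab) (root₀ : V) (root₀∈P : Rest c lab root₀) where
        open Invariant inv

        P : V → Set
        P = Rest c lab

        P? : Decidable P
        P? x = c ≤? lab x

        touches? : ∀ j → Dec (Touches lab c root₀ j)
        touches? j = any? λ u → any? λ w → (lab u ≟ j) ×-dec (reachable? P? root₀ w ×-dec edge? u w)

        L : List ℕ
        L = filter touches? (upTo c)

        L-touches : ∀ {j} → j ∈ L → j < c × Touches lab c root₀ j
        L-touches j∈ = let (j∈upTo , touch) = ∈-filter⁻ touches? j∈ in ∈-upTo⁻ j∈upTo , touch

        L-complete : ∀ {j} → j < c → Touches lab c root₀ j → j ∈ L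
        L-complete j<c touch = ∈-filter⁺ touches? (∈-upTo⁺ j<c) touch

        L-length : length L ≤ 2 + k
        L-length = width-bound inv ≤-refl root₀∈P L (filter⁺ touches? (upTo⁺ c)) (All.tabulate L-touches)

        Near : ℕ → V → Set
        Near j z = P z × ∃ λ u → lab u ≡ j × Edge G u z

        Near? : ∀ j → Decidable (Near j)
        Near? j z = P? z ×-dec any? λ u → (lab u ≟ j) ×-dec edge? u z

        Meets : ℕ → List V → Set
        Meets j H = ∃ λ a → ∃ λ b → lab a ≡ j × b ∈ H × Edge G a b

        meets-there : ∀ {j root} (s : Spoke P root) ss → Meets j (hull ss) → Meets j (hull (s ∷ ss))
        meets-there s ss (a , b , la , b∈ , e) = a , b , la , ∈-++⁺ʳ (spokeVertices s) b∈ , e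

        record Plan (J : List ℕ) : Set₁ where
          field
            root : V
            root-reach : Walk (IE P) root₀ root
            spokes : List (Spoke P root)
            root∈H : root ∈ hull spokes
            few-spokes : length spokes ≤ suc k
            meets : ∀ {j} → j ∈ J → Meets j (hull spokes)

        spokeTo : ∀ {root j} → Walk (IE P) root root₀ → Touches lab c root₀ j → Spoke P root
        spokeTo {j = j} back (u , w , lu , root₀⇝w , e) = record
          { target = Near j ; geo = geodesic P? (Near? j) (along root₀⇝w root₀∈P , u , lu , e) (back ++ʷ root₀⇝w) }

        spokesTo : ∀ {root J} → Walk (IE P) root root₀ → All (Touches lab c root₀) J → List (Spoke P root)
        spokesTo back [] = []
        spokesTo back (touch ∷ touches) = spokeTo back touch ∷ spokesTo back touches

        length-spokesTo : ∀ {root J} (back : Walk (IE P) root root₀) (touches : All (Touches lab c root₀) J) →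
          length (spokesTo back touches) ≡ length J
        length-spokesTo back [] = refl
        length-spokesTo back (_ ∷ touches) = cong suc (length-spokesTo back touches)

        spokesTo-meet : ∀ {root J} (back : Walk (IE P) root root₀) (touches : All (Touches lab c root₀) J) →
          ∀ {j} → j ∈ J → Meets j (hull (spokesTo back touches))
        spokesTo-meet back (touch ∷ touches) (here refl) =
          let s = spokeTo back touch
              (_ , u , lu , e) = end∈T (geo s)
          in u , end (geo s) , lu , ∈-++⁺ˡ (last∈ (path (geo s))) , e
        spokesTo-meet back (touch ∷ touches) (there j∈) =
          meets-there (spokeTo back touch) (spokesTo back touches) (spokesTo-meet back touches j∈)

        trivial-plan : Plan []
        trivial-plan = record
          { root = root₀ ; root-reach = here ; spokes = s ∷ [] ; root∈H = root∈hull s []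
          ; few-spokes = s≤s z≤n ; meets = λ () }
          where
          s : Spoke P root₀
          s = record { target = _≡ root₀ ; geo = geodesic P? (_≟ᶠ root₀) refl here }

        -- Otherwise root the spokes at a vertex w adjacent to the first touching
        -- part p, with one spoke towards each other touching part (or a trivial
        -- spoke towards p if there is none); p itself is met at w.
        plan-at : ∀ {p J} → Touches lab c root₀ p → All (Touches lab c root₀) J → length J ≤ suc k → Plan (p ∷ J)
        plan-at {p} touch@(u , w , lu , root₀⇝w , e) touches few = record
          { root = w ; root-reach = root₀⇝w ; spokes = fan touches ; root∈H = w∈fan touches
          ; few-spokes = fan-few touches few ; meets = fan-meets touches }
          where
          back : Walk (IE P) w root₀
          back = reverseʷ IE-sym root₀⇝w
          fan : ∀ {J'} → All (Touches lab c root₀) J' → List (Spoke P w)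
          fan [] = spokeTo back touch ∷ []
          fan touches'@(_ ∷ _) = spokesTo back touches'
          w∈fan : ∀ {J'} (touches' : All (Touches lab c root₀) J') → w ∈ hull (fan touches')
          w∈fan [] = root∈hull (spokeTo back touch) []
          w∈fan (touch' ∷ touches') = root∈hull (spokeTo back touch') (spokesTo back touches')
          fan-few : ∀ {J'} (touches' : All (Touches lab c root₀) J') → length J' ≤ suc k → length (fan touches') ≤ suc k
          fan-few [] _ = s≤s z≤n
          fan-few touches'@(_ ∷ _) few' = subst (_≤ suc k) (sym (length-spokesTo back touches')) few'
          fan-meets : ∀ {J'} (touches' : All (Touches lab c root₀) J') → ∀ {j} → j ∈ p ∷ J' → Meets j (hull (fan touches'))
          fan-meets touches' (here refl) = u , w , lu , w∈fan touches' , e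
          fan-meets touches'@(_ ∷ _) (there j∈) = spokesTo-meet back touches' j∈

        plan : ∀ {J} → All (Touches lab c root₀) J → length J ≤ 2 + k → Plan J
        plan [] _ = trivial-plan
        plan (touch ∷ touches) (s≤s few) = plan-at touch touches few

        open Plan (plan (All.tabulate (proj₂ ∘ L-touches)) L-length)

        H : List V
        H = hull spokes

        H⊆P : ∀ {x} → x ∈ H → P x
        H⊆P = hull⊆ spokes (along root-reach root₀∈P)

        H-connected : ∀ {x} → x ∈ H → Walk (IE (_∈ H)) root x
        H-connected = hull-connected spokes

        H-spreads : Spreads G P (_∈ H) (fₜ t)
        H-spreads = hull-spreads spokes few-spokes

        -- The new labelling: H becomes part c, the old parts keep their labels
        -- and all other vertices get label c+1.  It is kept abstract, and used
        -- only through the view Kind, so that case analyses stay cheap.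
        open import Data.List.Membership.DecPropositional (_≟ᶠ_ {N}) using (_∈?_)

        data Kind (x : V) : ℕ → Set where
          new-part : x ∈ H → Kind x c
          old-part : lab x < c → Kind x (lab x)
          unassigned : x ∉ H → c ≤ lab x → Kind x (suc c)

        abstract
          relabel : ∀ {x} → Dec (x ∈ H) → Dec (lab x < c) → ℕ
          relabel (yes _) _ = c
          relabel {x} (no _) (yes _) = lab x
          relabel (no _) (no _) = suc c

          lab' : V → ℕ
          lab' x = relabel (x ∈? H) (lab x <? c)

          kind : ∀ x → Kind x (lab' x)
          kind x = classify (x ∈? H) (lab x <? c)
            where
            classify : (d : Dec (x ∈ H)) (d' : Dec (lab x < c)) → Kind x (relabel d d')
            classify (yes x∈H) _ = new-part x∈H
            classify (no _) (yes lx<c) = old-part lx<c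
            classify (no x∉H) (no lx≮c) = unassigned x∉H (≮⇒≥ lx≮c)

        new⇐ : ∀ {x} → x ∈ H → lab' x ≡ c
        new⇐ {x} x∈H with lab' x | kind x
        ... | _ | new-part _ = refl
        ... | _ | old-part lx<c = ⊥-elim (<⇒≱ lx<c (H⊆P x∈H))
        ... | _ | unassigned x∉H _ = ⊥-elim (x∉H x∈H)

        new⇒ : ∀ {x} → lab' x ≡ c → x ∈ H
        new⇒ {x} eq with lab' x | kind x
        ... | _ | new-part x∈H = x∈H
        ... | _ | old-part lx<c = ⊥-elim (<⇒≢ lx<c eq)
        ... | _ | unassigned _ _ = ⊥-elim (1+n≢n eq)

        old⇒ : ∀ {x i} → i < c → lab' x ≡ i → lab x ≡ i
        old⇒ {x} i<c eq with lab' x | kind x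
        ... | _ | new-part _ = ⊥-elim (<⇒≢ i<c (sym eq))
        ... | _ | old-part _ = eq
        ... | _ | unassigned _ _ = ⊥-elim (<⇒≢ (m<n⇒m<1+n i<c) (sym eq))

        old⇐ : ∀ {x i} → i < c → lab x ≡ i → lab' x ≡ i
        old⇐ {x} i<c eq with lab' x | kind x
        ... | _ | new-part x∈H = ⊥-elim (<⇒≱ i<c (subst (c ≤_) eq (H⊆P x∈H)))
        ... | _ | old-part _ = eq
        ... | _ | unassigned _ c≤lx = ⊥-elim (<⇒≱ i<c (subst (c ≤_) eq c≤lx))

        rest⇒ : ∀ {x i} → i ≤ c → Rest i lab' x → Rest i lab x
        rest⇒ {x} i≤c i≤l' with lab' x | kind x
        ... | _ | new-part x∈H = ≤-trans i≤c (H⊆P x∈H)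
        ... | _ | old-part _ = i≤l'
        ... | _ | unassigned _ c≤lx = ≤-trans i≤c c≤lx

        rest⇐ : ∀ {x i} → i ≤ c → Rest i lab x → Rest i lab' x
        rest⇐ {x} i≤c i≤lx with lab' x | kind x
        ... | _ | new-part _ = i≤c
        ... | _ | old-part _ = i≤lx
        ... | _ | unassigned _ _ = m≤n⇒m≤1+n i≤c

        rest-next : ∀ {x} → Rest (suc c) lab' x → P x
        rest-next {x} c<l' with lab' x | kind x
        ... | _ | new-part _ = ⊥-elim (1+n≰n c<l')
        ... | _ | old-part lx<c = ⊥-elim (<-asym lx<c c<l')
        ... | _ | unassigned _ c≤lx = c≤lx

        below-next : ∀ {i} → i < suc c → i < c ⊎ i ≡ c
        below-next i<sc = m≤n⇒m<n∨m≡n (s≤s⁻¹ i<sc)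

        adjacent-old : ∀ {j j'} → j < c → j' < c → Adjacent lab j j' → Adjacent lab' j j'
        adjacent-old j<c j'<c (a , b , la , lb , e) = a , b , old⇐ j<c la , old⇐ j'<c lb , e

        touches-old : ∀ {i v j} → i ≤ c → j < c → Touches lab' i v j → Touches lab i v j
        touches-old i≤c j<c (u , w , lu , v⇝w , e) = u , w , old⇒ j<c lu , mapWalk (IE-map (rest⇒ i≤c)) v⇝w , e

        touches-next : ∀ {v j} → j < c → Touches lab' (suc c) v j → Touches lab c v j
        touches-next j<c (u , w , lu , v⇝w , e) = u , w , old⇒ j<c lu , mapWalk (IE-map rest-next) v⇝w , e

        -- A component of the new remainder touching H lies in the component of
        -- root₀, so every old part it touches is one of L, hence meets H.
        new-part-adjacent : ∀ {v j} → Rest (suc c) lab' v → j < c →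
          Touches lab' (suc c) v c → Touches lab' (suc c) v j → Adjacent lab' c j
        new-part-adjacent {v} {j} v∈Rest j<c (u , w , lu , v⇝w , e) touch-j =
          let (a , b , la , b∈H , e') = meets (L-complete j<c touch-root₀)
          in b , a , new⇐ b∈H , old⇐ j<c la , edge-sym e'
          where
          v⇝w' : Walk (IE P) v w
          v⇝w' = mapWalk (IE-map rest-next) v⇝w
          root₀⇝v : Walk (IE P) root₀ v
          root₀⇝v = root-reach ++ʷ (mapWalk (IE-map H⊆P) (H-connected (new⇒ lu))
                      ++ʷ step (H⊆P (new⇒ lu) , rest-next (along v⇝w v∈Rest) , e) (reverseʷ IE-sym v⇝w'))
          touch-root₀ : Touches lab c root₀ j
          touch-root₀ = let (u' , w' , lu' , v⇝w'' , e'') = touches-next j<c touch-j in u' , w' , lu' , root₀⇝v ++ʷ v⇝w'' , e''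

        touching-adjacent-next : TouchingAdjacent lab' (suc c)
        touching-adjacent-next v∈Rest j<sc j'<sc j≢j' touch touch' with below-next j<sc | below-next j'<sc
        ... | inj₁ j<c | inj₁ j'<c = adjacent-old j<c j'<c
          (touching-adjacent ≤-refl (rest-next v∈Rest) j<c j'<c j≢j' (touches-next j<c touch) (touches-next j'<c touch'))
        ... | inj₂ refl | inj₁ j'<c = new-part-adjacent v∈Rest j'<c touch touch'
        ... | inj₁ j<c | inj₂ refl = Adjacent-sym (new-part-adjacent v∈Rest j<c touch' touch)
        ... | inj₂ refl | inj₂ refl = ⊥-elim (j≢j' refl)

        invariant' : Invariant (suc c) lab'
        invariant' = record
          { part-nonempty = nonempty' ; part-connected = connected' ; part-spreads = spreads'
          ; touching-adjacent = touching-adjacent' }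
          where
          nonempty' : ∀ {i} → i < suc c → ∃ λ v → lab' v ≡ i
          nonempty' i<sc with below-next i<sc
          ... | inj₁ i<c = let (v , lv) = part-nonempty i<c in v , old⇐ i<c lv
          ... | inj₂ refl = root , new⇐ root∈H

          connected' : ∀ {i} → i < suc c → ∀ {u v} → lab' u ≡ i → lab' v ≡ i → Walk (IE (λ x → lab' x ≡ i)) u v
          connected' i<sc lu lv with below-next i<sc
          ... | inj₁ i<c = mapWalk (IE-map (old⇐ i<c)) (part-connected i<c (old⇒ i<c lu) (old⇒ i<c lv))
          ... | inj₂ refl = mapWalk (IE-map new⇐) (reverseʷ IE-sym (H-connected (new⇒ lu)) ++ʷ H-connected (new⇒ lv))

          spreads' : ∀ {i} → i < suc c → Spreads G (Rest i lab') (λ x → lab' x ≡ i) (fₜ t)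
          spreads' i<sc with below-next i<sc
          ... | inj₁ i<c = spreads-cong (rest⇒ (<⇒≤ i<c)) (rest⇐ (<⇒≤ i<c)) (old⇒ i<c) (part-spreads i<c)
          ... | inj₂ refl = spreads-cong (rest⇒ ≤-refl) (rest⇐ ≤-refl) new⇒ H-spreads

          touching-adjacent' : ∀ {i} → i ≤ suc c → TouchingAdjacent lab' i
          touching-adjacent' i≤sc with m≤n⇒m<n∨m≡n i≤sc
          ... | inj₂ refl = touching-adjacent-next
          ... | inj₁ (s≤s i≤c) = λ v∈Rest j<i j'<i j≢j' touch touch' →
            adjacent-old (≤-trans j<i i≤c) (≤-trans j'<i i≤c)
              (touching-adjacent i≤c (rest⇒ i≤c v∈Rest) j<i j'<i j≢j'
                 (touches-old i≤c (≤-trans j<i i≤c) touch) (touches-old i≤c (≤-trans j'<i i≤c) touch'))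

      -- Extending while some vertex is unassigned; at most N parts exist, so
      -- N+1 rounds of fuel suffice.
      complete : ∀ fuel {c lab} → N < fuel + c → Invariant c lab → Σ ℕ λ c' → Σ (V → ℕ) λ lab' →
        Invariant c' lab' × (∀ v → lab' v < c')
      complete fuel {c} {lab} N<fuel+c inv with any? (λ v → c ≤? lab v)
      ... | no none = c , lab , inv , λ v → ≰⇒> λ c≤lv → none (v , c≤lv)
      complete zero N<c inv | yes _ = ⊥-elim (<⇒≱ N<c (parts-bound inv))
      complete (suc fuel) {c} N<fuel+c inv | yes (v , c≤lv) =
        complete fuel (subst (N <_) (sym (+-suc fuel c)) N<fuel+c) (Extension.invariant' inv v c≤lv)

      decomposition-of : ∀ {c lab} → Invariant c lab → (∀ v → lab v < c) →
        Σ (Decomposition G) λ D → Connected D × Flat (fₜ t) D × WidthLe D (2 + k)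
      decomposition-of {c} {lab} inv assigned = D , connected , flat , width
        where
        open Invariant inv
        part-of : V → Fin c
        part-of v = fromℕ< (assigned v)
        toℕ-part-of : ∀ v → toℕ (part-of v) ≡ lab v
        toℕ-part-of v = toℕ-fromℕ< (assigned v)
        in⇒ : ∀ {x i} → part-of x ≡ i → lab x ≡ toℕ i
        in⇒ {x} refl = sym (toℕ-part-of x)
        in⇐ : ∀ {x i} → lab x ≡ toℕ i → part-of x ≡ i
        in⇐ {x} eq = toℕ-injective (trans (toℕ-part-of x) eq)
        rest⇒ : ∀ {x} {i : Fin c} → toℕ i ≤ toℕ (part-of x) → Rest (toℕ i) lab x
        rest⇒ {x} = subst (_ ≤_) (toℕ-part-of x)
        rest⇐ : ∀ {x} {i : Fin c} → Rest (toℕ i) lab x → toℕ i ≤ toℕ (part-of x)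
        rest⇐ {x} = subst (_ ≤_) (sym (toℕ-part-of x))
        D : Decomposition G
        D = record
          { ℓ = c ; part = part-of ; E = λ i → IE (λ x → part-of x ≡ i)
          ; E-sub = λ { i u v (u∈ , v∈ , e) → e , u∈ , v∈ }
          ; nonempty = λ i → let (v , lv) = part-nonempty (toℕ<n i) in v , in⇐ lv }
        connected : Connected D
        connected i u v u∈ v∈ = mapWalk (IE-map in⇐) (part-connected (toℕ<n i) (in⇒ u∈) (in⇒ v∈))
        flat : Flat (fₜ t) D
        flat i = spreads-cong (rest⇒ {i = i}) (rest⇐ {i = i}) in⇒ (part-spreads (toℕ<n i))
        width : WidthLe D (2 + k)
        width i v v∈Rest js distinct touching =
          subst (_≤ 2 + k) (length-map toℕ js)
            (width-bound inv (<⇒≤ (toℕ<n i)) (rest⇒ {i = i} v∈Rest) (map toℕ js) (Unique-map⁺ toℕ-injective distinct)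
              (All-map⁺ (All.map (λ { (j<i , u , w , u∈ , v⇝w , e) → j<i , u , w , in⇒ u∈ , mapWalk (IE-map (rest⇒ {i = i})) v⇝w , e }) touching)))

      decomposition : Σ (Decomposition G) λ D → Connected D × Flat (fₜ t) D × WidthLe D (2 + k)
      decomposition =
        let (c , lab , inv , assigned) = complete (suc N) (subst (N <_) (sym (+-identityʳ (suc N))) ≤-refl) invariant₀
        in decomposition-of inv assigned

lemma4p1 : (t : ℕ) → 4 ≤ t → (G : Graph) → ¬ HasKMinor t G →
    Σ (Decomposition G) λ D → Connected D × Flat (fₜ t) D × WidthLe D (t ∸ 2)
lemma4p1 .(4 + k) (s≤s (s≤s (s≤s (s≤s {n = k} z≤n)))) G noK = Construction.Greedy.decomposition G k noK
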